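{- For any nominal transition system $\mathbf T$, every formula $A$ over $\mathbf T$ and every state $P$: $P\models_{\mathbf T}A$ iff $P\models_{\mathcal S(\mathbf T)}\mathcal S(A)$.
   Context: Nominal sets over a countably infinite (possibly sorted) set of names $\mathcal N$: permutations fix all but finitely many names; every element has finite support $\operatorname{supp}$; $a\# X$ means $a\notin\operatorname{supp}(X)$; $[\mathcal P_{\mathrm{fin}}(\mathcal N)]S$ is $\mathcal P_{\mathrm{fin}}(\mathcal N)\times S$ modulo $(N,X)=_\alpha(N',X')$ iff some $\pi$ with $\pi\cdot(N,X)=(N',X')$ fixes every name of $\operatorname{supp}(X)\setminus N$; classes $\langle N\rangle X$. A nominal transition system: nominal sets STATES, PRED, ACT; equivariant $\vdash\subseteq\mathrm{STATES}\times\mathrm{PRED}$; equivariant $\operatorname{bn}$, $\operatorname{bn}(\alpha)$ a finite subset of $\operatorname{supp}(\alpha)$; equivariant $\rightarrow\ \subseteq\mathrm{STATES}\times[\mathcal P_{\mathrm{fin}}(\mathcal N)](\mathrm{ACT}\times\mathrm{STATES})$ with $(P,\langle N\rangle(\alpha,Q))\in\rightarrow$ only if $N=\operatorname{bn}(\alpha)$; $P\xrightarrow{\alpha}P'$ means $(P,\langle\operatorname{bn}(\alpha)\rangle(\alpha,P'))\in\rightarrow$. Formulas over a nominal transition system: fix an infinite cardinal $\kappa>\aleph_0$ with $\kappa>|\mathrm{STATES}|$; formulas are $\bigwedge_{i\in I}A_i$ (with $\{A_i\}$ of cardinality $<\kappa$ and finitely supported), $\neg A$, $\varphi\in\mathrm{PRED}$,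 $\langle\alpha\rangle A$ with $\operatorname{bn}(\alpha)$ bound in $\alpha$ and $A$. $P\models\bigwedge A_i$ iff all $P\models A_i$; $P\models\neg A$ iff not $P\models A$; $P\models\varphi$ iff $P\vdash\varphi$; $P\models\langle\alpha\rangle A$ iff for a representative with $\operatorname{bn}(\alpha)\# P$ some $P'$ has $P\xrightarrow{\alpha}P'$ and $P'\models A$. $\top$ is the empty conjunction. $\mathcal S(\mathbf T)$ is the nominal transition system with: same states as $\mathbf T$; actions $\mathrm{ACT}_{\mathbf T}\uplus\mathrm{PRED}_{\mathbf T}$; $\operatorname{bn}$ as in $\mathbf T$ on $\mathrm{ACT}_{\mathbf T}$ and $\operatorname{bn}(\varphi)=\emptyset$ for $\varphi\in\mathrm{PRED}_{\mathbf T}$; no state predicates hold; transitions $P\xrightarrow{\alpha}P'$ iff $P\xrightarrow{\alpha}P'$ in $\mathbf T$ (for $\alpha\in\mathrm{ACT}_{\mathbf T}$), and $P\xrightarrow{\varphi}P$ iff $P\vdash_{\mathbf T}\varphi$, with no other $\varphi$-transitions. The translation $\mathcal S$ from formulas over $\mathbf T$ to formulas over $\mathcal S(\mathbf T)$ is defined by $\mathcal S(\varphi)=\langle\varphi\rangle\top$, and homomorphically otherwise: $\mathcal S(\bigwedge A_i)=\bigwedge\mathcal S(A_i)$, $\mathcal S(\neg A)=\neg\mathcal S(A)$, $\mathcal S(\langle\alpha\rangle A)=\langle\alpha\rangle\mathcal S(A)$. -}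

module Defs where

open import Level using (Lift)
open import Data.Nat using (ℕ; _≥_)
open import Data.Empty using (⊥; ⊥-elim)
open import Data.Sum using (_⊎_; inj₁; inj₂)
open import Data.Product using (Σ; Σ-syntax; ∃; ∃-syntax; _×_; _,_)
open import Data.List using (List; []; _∷_; _++_)
open import Data.List.Membership.Propositional using (_∈_; _∉_)
open import Data.List.Membership.Propositional.Properties using (∈-++⁺ˡ; ∈-++⁺ʳ)
open import Relation.Binary.PropositionalEquality using (_≡_; refl; cong; trans)
open import Relation.Nullary using (¬_)
open import Function.Bundles using (_⇔_)

Name : Set
Name = ℕ

record Sorting : Set₁ where
  field
    Sort     : Set
    sort     : Name → Sort
    infinite : ∀ (s : Sort) (n : ℕ) → ∃[ m ] (m ≥ n × sort m ≡ s)

module Theory (𝕊 : Sorting) where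
  open Sorting 𝕊

  record Perm : Set where
    field
      to       : Name → Name
      from     : Name → Name
      to-from  : ∀ a → to (from a) ≡ a
      from-to  : ∀ a → from (to a) ≡ a
      sort-to  : ∀ a → sort (to a) ≡ sort a
      moved    : List Name
      finite   : ∀ a → a ∉ moved → to a ≡ a
  open Perm public

  idₚ : Perm
  idₚ = record
    { to = λ a → a ; from = λ a → a ; to-from = λ _ → refl ; from-to = λ _ → refl
    ; sort-to = λ _ → refl ; moved = [] ; finite = λ _ _ → refl }

  _∘ₚ_ : Perm → Perm → Perm
  σ ∘ₚ π = record
    { to = λ a → to σ (to π a)
    ; from = λ a → from π (from σ a)
    ; to-from = λ a → trans (cong (to σ) (to-from π (from σ a))) (to-from σ a)
    ; from-to = λ a → trans (cong (from π) (from-to σ (to π a))) (from-to π a)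
    ; sort-to = λ a → trans (sort-to σ (to π a)) (sort-to π a)
    ; moved = moved σ ++ moved π
    ; finite = λ a a∉ → trans (cong (to σ) (finite π a (λ a∈ → a∉ (∈-++⁺ʳ (moved σ) a∈))))
                              (finite σ a (λ a∈ → a∉ (∈-++⁺ˡ a∈)))
    }

  Fixes : Perm → List Name → Set
  Fixes π L = ∀ a → a ∈ L → to π a ≡ a

  record PermSet : Set₁ where
    field
      Carrier : Set
      act     : Perm → Carrier → Carrier

  module _ (X : PermSet) where
    open PermSet X

    Supports : List Name → Carrier → Set
    Supports L x = ∀ π → Fixes π L → act π x ≡ x

    -- a # x : a ∉ supp(x), i.e. some finite support of x avoids a
    Fresh : Name → Carrier → Set
    Fresh a x = ∃[ L ] (Supports L x × a ∉ L)

    record IsNominal : Set where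
      field
        act-id  : ∀ x → act idₚ x ≡ x
        act-∘   : ∀ σ π x → act (σ ∘ₚ π) x ≡ act σ (act π x)
        act-ext : ∀ π ρ x → (∀ a → to π a ≡ to ρ a) → act π x ≡ act ρ x
        finsupp : ∀ x → ∃[ L ] Supports L x

  _⊎ₚ_ : PermSet → PermSet → PermSet
  X ⊎ₚ Y = record
    { Carrier = PermSet.Carrier X ⊎ PermSet.Carrier Y
    ; act = λ { π (inj₁ x) → inj₁ (PermSet.act X π x) ; π (inj₂ y) → inj₂ (PermSet.act Y π y) } }

  -- The transition relation ⊆ STATES × [P_fin(N)](ACT × STATES), whose
  -- abstractions are always ⟨bn α⟩(α,P'), is given as the relation
  -- P ⟶[ α ] P' on representatives, required (IsNTS) to be invariant
  -- under alpha-conversion of ⟨bn α⟩(α,P').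

  record TS : Set₁ where
    field
      STATES PRED ACT : PermSet
      _⊢_     : PermSet.Carrier STATES → PermSet.Carrier PRED → Set
      bn      : PermSet.Carrier ACT → List Name
      _⟶[_]_ : PermSet.Carrier STATES → PermSet.Carrier ACT → PermSet.Carrier STATES → Set

  record IsNTS (T : TS) : Set₁ where
    open TS T
    private
      _·ₛ_ = PermSet.act STATES
      _·ₚ_ = PermSet.act PRED
      _·ₐ_ = PermSet.act ACT
    field
      STATES-nominal : IsNominal STATES
      PRED-nominal   : IsNominal PRED
      ACT-nominal    : IsNominal ACT
      ⊢-equivariant  : ∀ π P φ → P ⊢ φ → (π ·ₛ P) ⊢ (π ·ₚ φ)
      bn-equivariant : ∀ π α a → (a ∈ bn (π ·ₐ α)) ⇔ (from π a ∈ bn α)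
      bn-supp        : ∀ α a → a ∈ bn α → ¬ Fresh ACT a α
      ⟶-equivariant : ∀ π P α P' → P ⟶[ α ] P' → (π ·ₛ P) ⟶[ π ·ₐ α ] (π ·ₛ P')
      -- ⟨bn α⟩(α,P') =α ⟨bn α'⟩(α',P'') : some π maps (α,P') to (α',P'')
      -- and fixes supp(α,P') ∖ bn α
      ⟶-alpha : ∀ P α P' α' P'' π (L : List Name)
                 → Supports ACT L α → Supports STATES L P'
                 → (∀ a → a ∈ L → a ∉ bn α → to π a ≡ a)
                 → π ·ₐ α ≡ α' → π ·ₛ P' ≡ P''
                 → P ⟶[ α ] P' → P ⟶[ α' ] P''

  -- Formulas over a transition system.  Conjunctions are indexed by
  -- small types (I : Set, the universe of STATES).

  module Formulas (T : TS) where
    open TS T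
    State  = PermSet.Carrier STATES
    Pred   = PermSet.Carrier PRED
    Act    = PermSet.Carrier ACT
    _·ₛ_ = PermSet.act STATES
    _·ₚ_ = PermSet.act PRED
    _·ₐ_ = PermSet.act ACT

    data Form : Set₁ where
      ⋀     : (I : Set) → (I → Form) → Form
      ¬'    : Form → Form
      pred  : Pred → Form
      ⟨_⟩_ : Act → Form → Form

    ⊤' : Form
    ⊤' = ⋀ ⊥ ⊥-elim

    _·F_ : Perm → Form → Form
    π ·F ⋀ I f      = ⋀ I (λ i → π ·F f i)
    π ·F ¬' A       = ¬' (π ·F A)
    π ·F pred φ     = pred (π ·ₚ φ)
    π ·F (⟨ α ⟩ A) = ⟨ π ·ₐ α ⟩ (π ·F A)

    -- Alpha-equivalence: conjunctions are equal as sets of (classes of)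
    -- formulas; ⟨α⟩A is the class ⟨bn α⟩(α,A) in [P_fin(N)](ACT × Form).
    data _≈_ : Form → Form → Set₁ where
      ⋀≈    : ∀ {I J f g} → (∀ i → ∃[ j ] (f i ≈ g j)) → (∀ j → ∃[ i ] (f i ≈ g j))
             → ⋀ I f ≈ ⋀ J g
      ¬≈    : ∀ {A B} → A ≈ B → ¬' A ≈ ¬' B
      pred≈ : ∀ {φ} → pred φ ≈ pred φ
      ⟨⟩≈   : ∀ {α α' A A'} (π : Perm) (L : List Name)
             → Supports ACT L α → (∀ σ → Fixes σ L → (σ ·F A) ≈ A)
             → (∀ a → a ∈ L → a ∉ bn α → to π a ≡ a)
             → (∀ a → (a ∈ bn α') ⇔ (from π a ∈ bn α))
             → π ·ₐ α ≡ α' → (π ·F A) ≈ A'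
             → (⟨ α ⟩ A) ≈ (⟨ α' ⟩ A')

    data WF : Form → Set₁ where
      ⋀wf    : ∀ {I f} → (∀ i → WF (f i))
              → (∃[ L ] (∀ π → Fixes π L → (π ·F ⋀ I f) ≈ ⋀ I f))
              → WF (⋀ I f)
      ¬wf    : ∀ {A} → WF A → WF (¬' A)
      predwf : ∀ {φ} → WF (pred φ)
      ⟨⟩wf   : ∀ {α A} → WF A → WF (⟨ α ⟩ A)

    -- sat π P A  means  P ⊨ π·A  (the permutation is accumulated so that
    -- the definition is structurally recursive).
    sat : Perm → State → Form → Set₁
    sat π P (⋀ I f)     = ∀ i → sat π P (f i)
    sat π P (¬' A)      = ¬ sat π P A
    sat π P (pred φ)    = Lift _ (P ⊢ (π ·ₚ φ))
    sat π P (⟨ α ⟩ A)  =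
      -- a representative ⟨σ·π·α⟩(σ·π·A) of the class of ⟨π·α⟩(π·A)
      -- with bn(σ·π·α) # P, and some P' with P ⟶ P' and P' ⊨ σ·π·A
      Σ[ σ ∈ Perm ]
        ((⟨ π ·ₐ α ⟩ (π ·F A)) ≈ (⟨ σ ·ₐ (π ·ₐ α) ⟩ (σ ·F (π ·F A)))
        × (∀ a → a ∈ bn (σ ·ₐ (π ·ₐ α)) → Fresh STATES a P)
        × Σ[ P' ∈ State ] (P ⟶[ σ ·ₐ (π ·ₐ α) ] P' × sat (σ ∘ₚ π) P' A))

    _⊨_ : State → Form → Set₁
    P ⊨ A = sat idₚ P A

  𝒮 : TS → TS
  𝒮 T = record
    { STATES = STATES
    ; PRED   = PRED
    ; ACT    = ACT ⊎ₚ PRED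
    ; _⊢_    = λ _ _ → ⊥
    ; bn     = λ { (inj₁ α) → bn α ; (inj₂ φ) → [] }
    ; _⟶[_]_ = λ { P (inj₁ α) P' → P ⟶[ α ] P' ; P (inj₂ φ) P' → (P' ≡ P) × (P ⊢ φ) }
    }
    where open TS T

  𝒮F : (T : TS) → Formulas.Form T → Formulas.Form (𝒮 T)
  𝒮F T (Formulas.⋀ I f)      = Formulas.⋀ I (λ i → 𝒮F T (f i))
  𝒮F T (Formulas.¬' A)       = Formulas.¬' (𝒮F T A)
  𝒮F T (Formulas.pred φ)     = Formulas.⟨ inj₂ φ ⟩ Formulas.⊤' (𝒮 T)
  𝒮F T (Formulas.⟨ α ⟩ A)   = Formulas.⟨ inj₁ α ⟩ (𝒮F T A)

module Submission where

-- Satisfaction carries an accumulated permutation (sat π P A means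
-- P ⊨ π·A), so the statement is proved for every π by induction on A.
-- The translation does not commute on the nose with the permutation
-- action: π·𝒮(φ) = ⟨π·φ⟩⋀∅ has a different (but empty) family of
-- conjuncts than 𝒮(π·φ).  We therefore work with the relation
-- "X translates A" (𝒮(A) up to the bodies of empty conjunctions), which
-- is closed under permutations and contains every pair (A, 𝒮(A)).

open import Defs
open import Function.Bundles using (_⇔_; mk⇔; Equivalence)
open import Data.Empty using (⊥)
open import Data.Sum using (inj₁; inj₂)
open import Data.Sum.Properties using (inj₁-injective; inj₂-injective)
open import Data.Product using (∃-syntax; _,_; proj₁; proj₂)
open import Data.List.Membership.Propositional using (_∉_)
open import Level using (lift)
open import Relation.Binary.PropositionalEquality using (_≡_; refl; cong; trans; sym; subst)

module Translation (𝕊 : Sorting) where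
  open Theory 𝕊

  -- In any transition system, an action without binders is
  -- alpha-equivalent only to itself: the renaming witnessing the
  -- equivalence must fix a support of the action.
  unbound-≈ : (U : TS) → let open Formulas U in
    ∀ {α α' A A'} → (∀ a → a ∉ TS.bn U α) →
    (⟨ α ⟩ A) ≈ (⟨ α' ⟩ A') → α ≡ α'
  unbound-≈ U no-bn (Formulas.⟨⟩≈ ρ L supp _ fixes _ eq _) =
    trans (sym (supp ρ (λ a a∈L → fixes a a∈L (no-bn a)))) eq

  module _ (T : TS) (nts : IsNTS T) where
    open TS T using (PRED; ACT; _⊢_)
    open IsNTS nts using (PRED-nominal)
    open IsNominal using (act-id; finsupp)
    module FT = Formulas T
    module FS = Formulas (𝒮 T)

    -- X translates A: X is 𝒮(A) up to the bodies of empty conjunctions,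
    -- which permutations change (π·⊤ is not definitionally ⊤).
    data Translates : FT.Form → FS.Form → Set₁ where
      tr-⋀   : ∀ {I f g} → (∀ i → Translates (f i) (g i)) →
               Translates (FT.⋀ I f) (FS.⋀ I g)
      tr-¬   : ∀ {A X} → Translates A X → Translates (FT.¬' A) (FS.¬' X)
      tr-pred : ∀ {φ h} → Translates (FT.pred φ) (FS.⟨ inj₂ φ ⟩ FS.⋀ ⊥ h)
      tr-⟨⟩  : ∀ {α A X} → Translates A X →
               Translates (FT.⟨ α ⟩ A) (FS.⟨ inj₁ α ⟩ X)

    translates-𝒮F : ∀ A → Translates A (𝒮F T A)
    translates-𝒮F (FT.⋀ I f)    = tr-⋀ (λ i → translates-𝒮F (f i))
    translates-𝒮F (FT.¬' A)     = tr-¬ (translates-𝒮F A)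
    translates-𝒮F (FT.pred φ)   = tr-pred
    translates-𝒮F (FT.⟨ α ⟩ A) = tr-⟨⟩ (translates-𝒮F A)

    translates-act : ∀ π {A X} → Translates A X → Translates (π FT.·F A) (π FS.·F X)
    translates-act π (tr-⋀ t) = tr-⋀ (λ i → translates-act π (t i))
    translates-act π (tr-¬ t) = tr-¬ (translates-act π t)
    translates-act π tr-pred  = tr-pred
    translates-act π (tr-⟨⟩ t) = tr-⟨⟩ (translates-act π t)

    guard-support : ∀ φ → ∃[ L ] Supports (ACT ⊎ₚ PRED) L (inj₂ φ)
    guard-support φ with finsupp PRED-nominal φ
    ... | L , supp = L , λ π fixes → cong inj₂ (supp π fixes)

    guard-≈ : ∀ {φ φ' h h'} → PermSet.act PRED idₚ φ ≡ φ' →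
              (FS.⟨ inj₂ φ ⟩ FS.⋀ ⊥ h) FS.≈ (FS.⟨ inj₂ φ' ⟩ FS.⋀ ⊥ h')
    guard-≈ {φ} eq =
      FS.⟨⟩≈ idₚ (proj₁ (guard-support φ)) (proj₂ (guard-support φ))
        (λ _ _ → empty-≈) (λ _ _ _ → refl) (λ _ → mk⇔ (λ ()) (λ ()))
        (cong inj₂ eq) empty-≈
      where
        empty-≈ : ∀ {h h'} → FS.⋀ ⊥ h FS.≈ FS.⋀ ⊥ h'
        empty-≈ = FS.⋀≈ (λ ()) (λ ())

    guard-unbound-≈ : ∀ {φ φ' X Y} →
                      (FS.⟨ inj₂ φ ⟩ X) FS.≈ (FS.⟨ inj₂ φ' ⟩ Y) → φ ≡ φ'
    guard-unbound-≈ r = inj₂-injective (unbound-≈ (𝒮 T) (λ _ ()) r)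

    predEq : ∀ {φ φ'} → φ ≡ φ' → FT.pred φ FT.≈ FT.pred φ'
    predEq refl = FT.pred≈

    translate-≈ : ∀ {A B X Y} → Translates A X → Translates B Y → A FT.≈ B → X FS.≈ Y
    translate-≈ (tr-⋀ tf) (tr-⋀ tg) (FT.⋀≈ p q) =
      FS.⋀≈ (λ i → proj₁ (p i) , translate-≈ (tf i) (tg (proj₁ (p i))) (proj₂ (p i)))
            (λ j → proj₁ (q j) , translate-≈ (tf (proj₁ (q j))) (tg j) (proj₂ (q j)))
    translate-≈ (tr-¬ t) (tr-¬ u) (FT.¬≈ r) = FS.¬≈ (translate-≈ t u r)
    translate-≈ (tr-pred {φ}) tr-pred FT.pred≈ = guard-≈ (act-id PRED-nominal φ)
    translate-≈ (tr-⟨⟩ t) (tr-⟨⟩ u) (FT.⟨⟩≈ π L supp body fixes bn⇔ eq r) =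
      FS.⟨⟩≈ π L (λ σ f → cong inj₁ (supp σ f))
        (λ σ f → translate-≈ (translates-act σ t) t (body σ f))
        fixes bn⇔ (cong inj₁ eq) (translate-≈ (translates-act π t) u r)

    -- Translation reflects alpha-equivalence; mixed pairs ⟨φ⟩X, ⟨α⟩Y are
    -- never alpha-equivalent since a renaming preserves the summand.
    reflect-≈ : ∀ {A B X Y} → Translates A X → Translates B Y → X FS.≈ Y → A FT.≈ B
    reflect-≈ (tr-⋀ tf) (tr-⋀ tg) (FS.⋀≈ p q) =
      FT.⋀≈ (λ i → proj₁ (p i) , reflect-≈ (tf i) (tg (proj₁ (p i))) (proj₂ (p i)))
            (λ j → proj₁ (q j) , reflect-≈ (tf (proj₁ (q j))) (tg j) (proj₂ (q j)))
    reflect-≈ (tr-¬ t) (tr-¬ u) (FS.¬≈ r) = FT.¬≈ (reflect-≈ t u r)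
    reflect-≈ tr-pred tr-pred r = predEq (guard-unbound-≈ r)
    reflect-≈ tr-pred (tr-⟨⟩ _) (FS.⟨⟩≈ _ _ _ _ _ _ () _)
    reflect-≈ (tr-⟨⟩ _) tr-pred (FS.⟨⟩≈ _ _ _ _ _ _ () _)
    reflect-≈ (tr-⟨⟩ t) (tr-⟨⟩ u) (FS.⟨⟩≈ π L supp body fixes bn⇔ eq r) =
      FT.⟨⟩≈ π L (λ σ f → inj₁-injective (supp σ f))
        (λ σ f → reflect-≈ (translates-act σ t) t (body σ f))
        fixes bn⇔ (inj₁-injective eq) (reflect-≈ (translates-act π t) u r)

    sat-pred : ∀ π P φ h → FT.sat π P (FT.pred φ) ⇔ FS.sat π P (FS.⟨ inj₂ φ ⟩ FS.⋀ ⊥ h)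
    sat-pred π P φ h = mk⇔ loop-enabled holds
      where
        πφ = PermSet.act PRED π φ

        loop-enabled : FT.sat π P (FT.pred φ) → FS.sat π P (FS.⟨ inj₂ φ ⟩ FS.⋀ ⊥ h)
        loop-enabled (lift P⊢πφ) =
          idₚ , guard-≈ refl , (λ _ ()) , P ,
          (refl , subst (P ⊢_) (sym (act-id PRED-nominal πφ)) P⊢πφ) , (λ ())

        holds : FS.sat π P (FS.⟨ inj₂ φ ⟩ FS.⋀ ⊥ h) → FT.sat π P (FT.pred φ)
        holds (_ , r , _ , _ , (_ , P⊢σπφ) , _) =
          lift (subst (P ⊢_) (sym (guard-unbound-≈ r)) P⊢σπφ)

    -- In the modal case the chosen representative, its
    -- freshness condition and the transition are shared; only the
    -- alpha-equivalence and the residual formula are translated.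
    sat-translates : ∀ {A X} → Translates A X → ∀ π P → FT.sat π P A ⇔ FS.sat π P X
    sat-translates (tr-⋀ t) π P =
      mk⇔ (λ h i → Equivalence.to (sat-translates (t i) π P) (h i))
          (λ h i → Equivalence.from (sat-translates (t i) π P) (h i))
    sat-translates (tr-¬ t) π P =
      mk⇔ (λ h s → h (Equivalence.from (sat-translates t π P) s))
          (λ h s → h (Equivalence.to (sat-translates t π P) s))
    sat-translates (tr-pred {φ} {h}) π P = sat-pred π P φ h
    sat-translates (tr-⟨⟩ {α} {A} {X} t) π P = mk⇔ forth back
      where
        tπ = translates-act π t

        forth : FT.sat π P (FT.⟨ α ⟩ A) → FS.sat π P (FS.⟨ inj₁ α ⟩ X)
        forth (σ , r , fresh , P' , P⟶P' , P'⊨A) =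
          σ , translate-≈ (tr-⟨⟩ tπ) (tr-⟨⟩ (translates-act σ tπ)) r , fresh , P' , P⟶P' ,
          Equivalence.to (sat-translates t (σ ∘ₚ π) P') P'⊨A

        back : FS.sat π P (FS.⟨ inj₁ α ⟩ X) → FT.sat π P (FT.⟨ α ⟩ A)
        back (σ , r , fresh , P' , P⟶P' , P'⊨X) =
          σ , reflect-≈ (tr-⟨⟩ tπ) (tr-⟨⟩ (translates-act σ tπ)) r , fresh , P' , P⟶P' ,
          Equivalence.from (sat-translates t (σ ∘ₚ π) P') P'⊨X

theorem8p5 : (𝕊 : Sorting) → let open Theory 𝕊 in
    (T : TS) → IsNTS T →
    (A : Formulas.Form T) → Formulas.WF T A →
    (P : Formulas.State T) →
    (Formulas._⊨_ T P A) ⇔ (Formulas._⊨_ (𝒮 T) P (𝒮F T A))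
theorem8p5 𝕊 T nts A _ P =
  sat-translates T nts (translates-𝒮F T nts A) (Theory.idₚ 𝕊) P
  where open Translation 𝕊
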